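{- Let $\mathbf{K}$ be an order-enriched, left distributive category with arbitrary non-empty joins, let $J\colon\mathbf{J}\to\mathbf{K}$ exhibit a wide subcategory, and let $q\colon M\to N$ be a surjective monoid homomorphism. Then the functor $\Sigma_q\circ[q,\mathbf{K}]^J$ is the identity on $[\mathbf{N},\mathbf{K}]^J$; i.e. $\Sigma_q(\pi'\circ q)=\pi'$ for every $\pi'\in[\mathbf{N},\mathbf{K}]^J$ (and it is the identity on morphisms).
   Context: Order-enriched category: hom-sets partially ordered, composition monotone. Arbitrary non-empty joins: every hom-poset has suprema of non-empty subsets. Left distributive: $f\circ(\bigvee_i g_i)=\bigvee_i f\circ g_i$ for non-empty families. $J$ exhibits a wide subcategory: identity on objects, injective on morphisms. A monoid $M$ is viewed as a one-object category $\mathbf{M}$; a lax functor $\pi$ from $\mathbf{M}$ to $\mathbf{K}$ is an object $\pi(\ast)$ with endomorphisms $\pi_m$ satisfying $id\leq\pi_1$, $\pi_m\circ\pi_{m'}\leq\pi_{m\cdot m'}$. $[\mathbf{M},\mathbf{K}]^J$: objects lax functors; morphisms $\pi\to\pi'$ are $f\colon\pi(\ast)\to\pi'(\ast)$ in $\mathbf{J}$ with $J(f)\circ\pi_m\leq\pi'_m\circ J(f)$. $[q,\mathbf{K}]^J\colon[\mathbf{N},\mathbf{K}]^J\to[\mathbf{M},\mathbf{K}]^J$ sends $\pi'$ to $\pi'\circ q$ (same object, components $\pi'_{q(m)}$) and $f$ to $f$. $\Sigma_q\colon[\mathbf{M},\mathbf{K}]^J\to[\mathbf{N},\mathbf{K}]^J$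 is identity on morphisms and sends $\pi$ to $\Sigma_q(\pi)(\ast)=\pi(\ast)$, $\Sigma_q(\pi)_n=\bigvee_{i<\omega}\Pi_{n,i}$ with $\Pi_{n,0}=\bigvee\{\pi_m\mid q(m)=n\}$, $\Pi_{n,i+1}=\bigvee\{\Pi_{n_1,i}\circ\cdots\circ\Pi_{n_l,i}\mid l\ge1,\ n_1\cdots n_l=n\}$. -}

module Defs where

open import Level using (Level; _⊔_; Lift; lift) renaming (suc to lsuc)
open import Data.Nat using (ℕ; zero; suc)
open import Data.Product using (Σ; _,_; proj₁; proj₂; ∃)
open import Data.List.NonEmpty using (List⁺; [_]; foldr₁) renaming (map to map⁺)
open import Relation.Binary.PropositionalEquality using (_≡_; refl; subst; sym)
open import Relation.Binary.Structures using (IsPartialOrder)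
open import Algebra.Bundles using (Monoid)
open import Algebra.Morphism.Structures using (IsMonoidHomomorphism)

record Category (o h : Level) : Set (lsuc (o ⊔ h)) where
  infixr 9 _∘_
  field
    Obj : Set o
    Hom : Obj → Obj → Set h
    id  : ∀ {A} → Hom A A
    _∘_ : ∀ {A B C} → Hom B C → Hom A B → Hom A C
    assoc : ∀ {A B C D} (f : Hom C D) (g : Hom B C) (k : Hom A B) →
            (f ∘ g) ∘ k ≡ f ∘ (g ∘ k)
    identityˡ : ∀ {A B} (f : Hom A B) → id ∘ f ≡ f
    identityʳ : ∀ {A B} (f : Hom A B) → f ∘ id ≡ f

-- Non-empty joins are joins of families indexed by an inhabited
-- type of size ι (the element `i₀` witnesses non-emptiness).

record OrderEnrichedCat (o h r ι : Level) : Set (lsuc (o ⊔ h ⊔ r ⊔ ι)) where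
  field
    cat : Category o h
  open Category cat public
  infix 4 _≤_
  field
    _≤_ : ∀ {A B} → Hom A B → Hom A B → Set r
    isPartialOrder : ∀ {A B} → IsPartialOrder (_≡_ {A = Hom A B}) _≤_
    ∘-mono : ∀ {A B C} {f f′ : Hom B C} {g g′ : Hom A B} →
             f ≤ f′ → g ≤ g′ → f ∘ g ≤ f′ ∘ g′
    ⋁ : ∀ {A B} {I : Set ι} → I → (I → Hom A B) → Hom A B
    ⋁-upper : ∀ {A B} {I : Set ι} (i₀ : I) (f : I → Hom A B) (i : I) →
              f i ≤ ⋁ i₀ f
    ⋁-least : ∀ {A B} {I : Set ι} (i₀ : I) (f : I → Hom A B) (x : Hom A B) →
              (∀ i → f i ≤ x) → ⋁ i₀ f ≤ x
    distribˡ : ∀ {A B C} {I : Set ι} (i₀ : I) (f : Hom B C) (g : I → Hom A B) →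
               f ∘ ⋁ i₀ g ≡ ⋁ i₀ (λ i → f ∘ g i)

record WideSubcategory {o h : Level} (K : Category o h) (h′ : Level)
       : Set (lsuc h′ ⊔ o ⊔ h) where
  open Category K
  field
    HomJ : Obj → Obj → Set h′
    idJ  : ∀ {A} → HomJ A A
    _∘J_ : ∀ {A B C} → HomJ B C → HomJ A B → HomJ A C
    assocJ : ∀ {A B C D} (f : HomJ C D) (g : HomJ B C) (k : HomJ A B) →
             (f ∘J g) ∘J k ≡ f ∘J (g ∘J k)
    identityˡJ : ∀ {A B} (f : HomJ A B) → idJ ∘J f ≡ f
    identityʳJ : ∀ {A B} (f : HomJ A B) → f ∘J idJ ≡ f
    J : ∀ {A B} → HomJ A B → Hom A B
    J-id : ∀ {A} → J (idJ {A}) ≡ id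
    J-∘  : ∀ {A B C} (f : HomJ B C) (g : HomJ A B) → J (f ∘J g) ≡ J f ∘ J g
    J-injective : ∀ {A B} {f g : HomJ A B} → J f ≡ J g → f ≡ g

-- Lax functors 𝐌 → K from the one-object category of a monoid M.
-- (Functoriality on the hom-setoid of 𝐌 means respecting ≈ of M.)

module _ {o h r ι : Level} (K : OrderEnrichedCat o h r ι) where
  open OrderEnrichedCat K

  record LaxFunctor {c ℓ : Level} (M : Monoid c ℓ) : Set (o ⊔ h ⊔ r ⊔ c ⊔ ℓ) where
    open Monoid M renaming (Carrier to |M|; _≈_ to _≈M_; _∙_ to _·_; ε to e)
    field
      obj  : Obj
      act  : |M| → Hom obj obj
      resp : ∀ {m m′} → m ≈M m′ → act m ≡ act m′
      unit : id ≤ act e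
      mult : ∀ m m′ → act m ∘ act m′ ≤ act (m · m′)

  open LaxFunctor

  record LaxMorphism {h′ c ℓ : Level} (W : WideSubcategory cat h′)
         {M : Monoid c ℓ} (π π′ : LaxFunctor M) : Set (h′ ⊔ r ⊔ c) where
    open WideSubcategory W
    field
      mor  : HomJ (obj π) (obj π′)
      comm : ∀ m → J mor ∘ act π m ≤ act π′ m ∘ J mor

  module _ {c₁ ℓ₁ c₂ ℓ₂ : Level} {M : Monoid c₁ ℓ₁} {N : Monoid c₂ ℓ₂}
           (q : Monoid.Carrier M → Monoid.Carrier N)
           (q-hom : IsMonoidHomomorphism (Monoid.rawMonoid M) (Monoid.rawMonoid N) q)
           where
    open IsMonoidHomomorphism q-hom
    private
      module M = Monoid M
      module N = Monoid N
      module PO {A B} = IsPartialOrder (isPartialOrder {A} {B})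

    -- [q, K]^J on objects: π′ ↦ π′ ∘ q
    restrict : LaxFunctor N → LaxFunctor M
    restrict π′ = record
      { obj  = obj π′
      ; act  = λ m → act π′ (q m)
      ; resp = λ e → resp π′ (⟦⟧-cong e)
      ; unit = subst (id ≤_) (sym (resp π′ ε-homo)) (unit π′)
      ; mult = λ m m′ → subst (act π′ (q m) ∘ act π′ (q m′) ≤_)
                              (sym (resp π′ (homo m m′)))
                              (mult π′ (q m) (q m′))
      }

    -- [q, K]^J on morphisms: f ↦ f
    restrictMor : ∀ {h′} {W : WideSubcategory cat h′} {π π′ : LaxFunctor N} →
                  LaxMorphism W π π′ → LaxMorphism W (restrict π) (restrict π′)
    restrictMor f = record { mor = LaxMorphism.mor f
                           ; comm = λ m → LaxMorphism.comm f (q m) }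

  Surjective : ∀ {c₁ ℓ₁ c₂ ℓ₂} {M : Monoid c₁ ℓ₁} {N : Monoid c₂ ℓ₂} → (Monoid.Carrier M → Monoid.Carrier N) → Set (c₁ ⊔ c₂ ⊔ ℓ₂)
  Surjective {M = M} {N = N} q = ∀ n → Σ (Monoid.Carrier M) (λ m → Monoid._≈_ N (q m) n)

-- Joins in K are indexed by types of size
-- ι = c₁ ⊔ ℓ₁ ⊔ c₂ ⊔ ℓ₂; the index sets used below are lifted to ι.
-- Σ_q(π)(∗) = π(∗), Σ_q(π)_n = ⋁_{i<ω} Π_{n,i}, where
--   Π_{n,0}   = ⋁ { π_m | q(m) = n }
--   Π_{n,i+1} = ⋁ { Π_{n₁,i} ∘ ⋯ ∘ Π_{n_l,i} | l ≥ 1, n₁ ⋯ n_l = n }.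
-- Non-emptiness witnesses: surjectivity of q for Π_{n,0}, the one-element
-- list [n] for Π_{n,i+1}, and i = 0 for the ω-indexed join.

module _ {o h r c₁ ℓ₁ c₂ ℓ₂ : Level}
         (K : OrderEnrichedCat o h r (c₁ ⊔ ℓ₁ ⊔ c₂ ⊔ ℓ₂))
         {M : Monoid c₁ ℓ₁} {N : Monoid c₂ ℓ₂}
         (q : Monoid.Carrier M → Monoid.Carrier N)
         (surj : Surjective K {M = M} {N = N} q)
         (π : LaxFunctor K M)
         where
  open OrderEnrichedCat K
  private
    module M = Monoid M
    module N = Monoid N
    ι = c₁ ⊔ ℓ₁ ⊔ c₂ ⊔ ℓ₂
    X = LaxFunctor.obj π

  prod⁺ : List⁺ N.Carrier → N.Carrier
  prod⁺ = foldr₁ N._∙_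

  comp⁺ : List⁺ (Hom X X) → Hom X X
  comp⁺ = foldr₁ _∘_

  Π : ℕ → N.Carrier → Hom X X
  Π zero n =
    ⋁ {I = Lift ι (Σ M.Carrier (λ m → q m N.≈ n))}
      (lift (surj n))
      (λ { (lift (m , _)) → LaxFunctor.act π m })
  Π (suc i) n =
    ⋁ {I = Lift ι (Σ (List⁺ N.Carrier) (λ ns → prod⁺ ns N.≈ n))}
      (lift ([ n ] , N.refl))
      (λ { (lift (ns , _)) → comp⁺ (map⁺ (Π i) ns) })

  Σq-act : N.Carrier → Hom X X
  Σq-act n = ⋁ {I = Lift ι ℕ} (lift 0) (λ { (lift i) → Π i n })

  Σq-obj : Obj
  Σq-obj = X

module Submission where

-- Let π = π′ ∘ q be the restriction of a lax functor π′ on N.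
-- We show that every stage Π_{n,i} of the construction of Σ_q(π) already
-- equals π′_n; then Σ_q(π)_n, the ω-join of these stages, equals π′_n too,
-- while Σ_q(π)(∗) = π(∗) = π′(∗) holds by definition.
--
-- Stage 0 is a join of the π′_{q m} with q m ≈ n, all equal to π′_n.
-- Stage i+1 is a join of composites Π_{n₁,i} ∘ ⋯ ∘ Π_{n_l,i} with
-- n₁ ⋯ n_l ≈ n; by induction these are composites of π′_{nⱼ}, hence below
-- π′_n by laxity, and the one-element list [n] shows the join is at least
-- π′_n.  Antisymmetry gives equality at every stage.

open import Defs
open import Level using (Level; _⊔_; lift)
open import Data.Nat using (ℕ; zero; suc)
open import Data.Product using (_×_; _,_)
open import Data.List using ([]; _∷_)
open import Data.List.NonEmpty using (List⁺; _∷_; [_]; foldr₁) renaming (map to map⁺)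
open import Relation.Binary.PropositionalEquality using (_≡_; refl; subst)
open import Relation.Binary.Structures using (IsPartialOrder)
open import Algebra.Bundles using (Monoid)
open import Algebra.Morphism.Structures using (IsMonoidHomomorphism)

module Joins {o h r ι : Level} (K : OrderEnrichedCat o h r ι) where
  open OrderEnrichedCat K
  private
    module PO {A B} = IsPartialOrder (isPartialOrder {A} {B})

  ⋁-const : ∀ {A B} {I : Set ι} (i₀ : I) (f : I → Hom A B) (x : Hom A B) →
            (∀ i → f i ≡ x) → ⋁ i₀ f ≡ x
  ⋁-const i₀ f x f≡x = PO.antisym
    (⋁-least i₀ f x (λ i → PO.reflexive (f≡x i)))
    (subst (_≤ ⋁ i₀ f) (f≡x i₀) (⋁-upper i₀ f i₀))

module LaxComposites {o h r ι c ℓ : Level} (K : OrderEnrichedCat o h r ι)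
                     {N : Monoid c ℓ} (π′ : LaxFunctor K N) where
  open OrderEnrichedCat K
  open Monoid N using (Carrier; _∙_)
  open LaxFunctor π′ using (obj; act; mult)
  private
    module PO {A B} = IsPartialOrder (isPartialOrder {A} {B})

  composite-below : (g : Carrier → Hom obj obj) → (∀ n → g n ≤ act n) →
                    ∀ n ns → foldr₁ _∘_ (map⁺ g (n ∷ ns)) ≤ act (foldr₁ _∙_ (n ∷ ns))
  composite-below g g≤act n []       = g≤act n
  composite-below g g≤act n (m ∷ ms) =
    PO.trans (∘-mono (g≤act n) (composite-below g g≤act m ms))
             (mult n (foldr₁ _∙_ (m ∷ ms)))

module SigmaOfRestriction {o h r c₁ ℓ₁ c₂ ℓ₂ : Level}
    (K : OrderEnrichedCat o h r (c₁ ⊔ ℓ₁ ⊔ c₂ ⊔ ℓ₂))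
    {M : Monoid c₁ ℓ₁} {N : Monoid c₂ ℓ₂}
    (q : Monoid.Carrier M → Monoid.Carrier N)
    (q-hom : IsMonoidHomomorphism (Monoid.rawMonoid M) (Monoid.rawMonoid N) q)
    (surj : Surjective K {M = M} {N = N} q)
    (π′ : LaxFunctor K N) where
  open OrderEnrichedCat K
  open Monoid N using (Carrier) renaming (refl to ≈-refl)
  open LaxFunctor π′ using (act; resp)
  open Joins K using (⋁-const)
  open LaxComposites K π′ using (composite-below)
  private
    module PO {A B} = IsPartialOrder (isPartialOrder {A} {B})

  Πᵣ : ℕ → Carrier → Hom (LaxFunctor.obj π′) (LaxFunctor.obj π′)
  Πᵣ = Π K {M = M} {N = N} q surj (restrict K q q-hom π′)

  -- Stage 0: every π_m = π′_{q m} with q m ≈ n equals π′_n.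
  Π-zero : ∀ n → Πᵣ zero n ≡ act n
  Π-zero n = ⋁-const _ _ _ (λ { (lift (m , qm≈n)) → resp qm≈n })

  -- Stage i+1 agrees with π′ as soon as stage i does: its composites are
  -- below π′_n by laxity, and the singleton [n] contributes π′_n itself.
  Π-step : ∀ i → (∀ n → Πᵣ i n ≡ act n) → ∀ n → Πᵣ (suc i) n ≡ act n
  Π-step i stage n = PO.antisym
    (⋁-least _ _ (act n) (λ { (lift (m ∷ ms , prod≈n)) →
       subst (foldr₁ _∘_ (map⁺ (Πᵣ i) (m ∷ ms)) ≤_) (resp prod≈n)
             (composite-below (Πᵣ i) (λ k → PO.reflexive (stage k)) m ms) }))
    (subst (_≤ Πᵣ (suc i) n) (stage n) (⋁-upper _ _ (lift ([ n ] , ≈-refl))))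

  Π-stable : ∀ i n → Πᵣ i n ≡ act n
  Π-stable zero    = Π-zero
  Π-stable (suc i) = Π-step i (Π-stable i)

  Σq-restrict : ∀ n → Σq-act K {M = M} {N = N} q surj (restrict K q q-hom π′) n ≡ act n
  Σq-restrict n = ⋁-const _ _ _ (λ { (lift i) → Π-stable i n })

-- Proposition 4.4: Σ_q ∘ [q, K]^J is the identity on objects (on morphisms
-- both functors are the identity by definition).
proposition4p4 : ∀ {o h r h′ c₁ ℓ₁ c₂ ℓ₂ : Level}
    (K : OrderEnrichedCat o h r (c₁ ⊔ ℓ₁ ⊔ c₂ ⊔ ℓ₂))
    (W : WideSubcategory (OrderEnrichedCat.cat K) h′)
    (M : Monoid c₁ ℓ₁) (N : Monoid c₂ ℓ₂)
    (q : Monoid.Carrier M → Monoid.Carrier N)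
    (q-hom : IsMonoidHomomorphism (Monoid.rawMonoid M) (Monoid.rawMonoid N) q)
    (surj : Surjective K {M = M} {N = N} q)
    (π′ : LaxFunctor K N) →
    (Σq-obj K {M = M} {N = N} q surj (restrict K q q-hom π′) ≡ LaxFunctor.obj π′)
    × (∀ n → Σq-act K {M = M} {N = N} q surj (restrict K q q-hom π′) n ≡ LaxFunctor.act π′ n)
proposition4p4 K W M N q q-hom surj π′ =
  refl , SigmaOfRestriction.Σq-restrict K q q-hom surj π′
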